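{- For every integer $n>0$, \[ J_{n+1}=n+J_{n-1}+\sum_{k=3}^n(2k-5)J_{n+1-k}. \]
   Context: Jacobsthal numbers: $J_0=0$, $J_1=1$, $J_k=J_{k-1}+2J_{k-2}$ for $k\ge2$. An empty sum is $0$. -}

module Defs where

open import Data.Nat using (ℕ; zero; suc; _+_; _*_; _∸_; _<_)

J : ℕ → ℕ
J zero = 0
J (suc zero) = 1
J (suc (suc k)) = J (suc k) + 2 * J k

sumCount : ℕ → ℕ → (ℕ → ℕ) → ℕ
sumCount a zero    f = 0
sumCount a (suc c) f = f a + sumCount (suc a) c f

sumFromTo : ℕ → ℕ → (ℕ → ℕ) → ℕ
sumFromTo a b f = sumCount a (suc b ∸ a) f

-- Reindexing k = 3 + i turns the sum into the convolution Σ_{i<m} (2i+1) J(m−i)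
-- of the odd numbers with J.  Starting the odd weights at 2t+1 instead, that
-- convolution G t c satisfies G t c + t + c + 2 = (t+1) J(c+2) + J(c+1): peeling
-- off the first term reduces it to the same identity for t+1 and c, so it
-- follows by induction on c.  At t = 0 this, together with
-- J(m+3) = J(m+2) + 2 J(m+1), is the theorem for n = m + 2.
module Submission where

open import Defs
open import Data.Nat using (ℕ; zero; suc; _+_; _*_; _∸_; _<_)
open import Data.Nat.Properties using (+-comm; +-suc; *-distribˡ-+; m+n∸m≡n)
open import Data.Nat.Tactic.RingSolver using (solve-∀)
open import Relation.Binary.PropositionalEquality hiding (J)
open ≡-Reasoning

oddWeightedSum : ℕ → ℕ → ℕ
oddWeightedSum t zero    = 0
oddWeightedSum t (suc c) = (1 + 2 * t) * J (suc c) + oddWeightedSum (suc t) c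

oddWeightedSum-closed : ∀ t c → oddWeightedSum t c + t + c + 2 ≡ suc t * J (2 + c) + J (1 + c)
oddWeightedSum-closed t zero = base t
  where
  base : ∀ t → 0 + t + 0 + 2 ≡ suc t * 1 + 1
  base = solve-∀
oddWeightedSum-closed t (suc c) = begin
  (1 + 2 * t) * a + w + t + suc c + 2      ≡⟨ regroup t c a w ⟩
  (1 + 2 * t) * a + (w + suc t + c + 2)    ≡⟨ cong ((1 + 2 * t) * a +_) (oddWeightedSum-closed (suc t) c) ⟩
  (1 + 2 * t) * a + (suc (suc t) * b + a)  ≡⟨ collect t a b ⟩
  suc t * (b + 2 * a) + b                  ∎
  where
  a = J (1 + c)
  b = J (2 + c)
  w = oddWeightedSum (suc t) c
  regroup : ∀ t c a w → (1 + 2 * t) * a + w + t + suc c + 2 ≡ (1 + 2 * t) * a + (w + suc t + c + 2)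
  regroup = solve-∀
  collect : ∀ t a b → (1 + 2 * t) * a + (suc (suc t) * b + a) ≡ suc t * (b + 2 * a) + b
  collect = solve-∀

summand : ℕ → ℕ → ℕ
summand n k = (2 * k ∸ 5) * J (n + 1 ∸ k)

2*[3+t]∸5≡1+2*t : ∀ t → 2 * (3 + t) ∸ 5 ≡ 1 + 2 * t
2*[3+t]∸5≡1+2*t t = cong (_∸ 5) (*-distribˡ-+ 2 3 t)

sumCount-summand : ∀ n t c → n + 1 ≡ 3 + t + c → sumCount (3 + t) c (summand n) ≡ oddWeightedSum t c
sumCount-summand n t zero    _  = refl
sumCount-summand n t (suc c) eq =
  cong₂ _+_ (cong₂ _*_ (2*[3+t]∸5≡1+2*t t) (cong J index))
            (sumCount-summand n (suc t) c (trans eq (cong (3 +_) (+-suc t c))))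
  where
  index : n + 1 ∸ (3 + t) ≡ suc c
  index rewrite eq = m+n∸m≡n (3 + t) (suc c)

mainTheorem19 : (n : ℕ) → 0 < n →
    J (n + 1) ≡ n + J (n ∸ 1) + sumFromTo 3 n (λ k → (2 * k ∸ 5) * J (n + 1 ∸ k))
mainTheorem19 (suc zero)    _ = refl
mainTheorem19 (suc (suc m)) _ = begin
  J (suc (suc m) + 1)                      ≡⟨ cong (λ k → J (2 + k)) (+-comm m 1) ⟩
  J (2 + m) + 2 * J (1 + m)                ≡⟨ split (J (2 + m)) (J (1 + m)) ⟩
  (1 * J (2 + m) + J (1 + m)) + J (1 + m)  ≡⟨ cong (_+ J (1 + m)) (sym (oddWeightedSum-closed 0 m)) ⟩
  (S + 0 + m + 2) + J (1 + m)              ≡⟨ rearrange S m (J (1 + m)) ⟩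
  suc (suc m) + J (suc m) + S              ≡⟨ cong (suc (suc m) + J (suc m) +_) (sym sumIsOddWeighted) ⟩
  suc (suc m) + J (suc m) + sumCount 3 m (summand (suc (suc m))) ∎
  where
  S = oddWeightedSum 0 m
  sumIsOddWeighted : sumCount 3 m (summand (suc (suc m))) ≡ S
  sumIsOddWeighted = sumCount-summand (suc (suc m)) 0 m (cong (2 +_) (+-comm m 1))
  split : ∀ b a → b + 2 * a ≡ (1 * b + a) + a
  split = solve-∀
  rearrange : ∀ S m a → (S + 0 + m + 2) + a ≡ suc (suc m) + a + S
  rearrange = solve-∀
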